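{- Let $r\ge2$ and $m\ge1$, let $s_1,\dots,s_r$ be independent indeterminates over $\mathbb{Q}$, and $\varphi(t)=1+s_1t+\cdots+s_rt^r$. Then (i) $P\!\left(-\frac{r-1}{r},-\frac{r-2}{r},\dots,-\frac{r-m}{r}\right)\,S_m\!\left(r-\frac{t\varphi'(t)}{\varphi(t)}\right)\,Q\!\left(\frac{r-1}{r},\frac{r-2}{r},\dots,\frac{r-m}{r}\right)=r\,I_m$; (ii) $P\!\left(-\frac{r-1}{r},\dots,-\frac{r-m}{r}\right)\,D\,Q\!\left(\frac{r-1}{r},\dots,\frac{r-m}{r}\right)=D$, where $D=\mathrm{diag}(r-1,r-2,\dots,r-m)$.
   Context: For $\lambda\in\mathbb{C}$ and $\ell\in\mathbb{Z}$, $\beta_\ell(\lambda)$ is the coefficient of $t^\ell$ in the power series $\varphi(t)^\lambda$ (so $\beta_0(\lambda)=1$ and $\beta_\ell(\lambda)=0$ for $\ell<0$). For $\lambda_1,\dots,\lambda_m$, $P(\lambda_1,\dots,\lambda_m)$ is the $m\times m$ matrix with $(i,j)$ entry $\beta_{i-j}(\lambda_i)$; for $\mu_1,\dots,\mu_m$, $Q(\mu_1,\dots,\mu_m)$ is the $m\times m$ matrix with $(i,j)$ entry $\beta_{i-j}(\mu_j)$. For a power series $\psi(t)=a_0+a_1t+\cdots$, $S_m(\psi(t))$ is the $m\times m$ matrix with $(i,j)$ entry $a_{i-j}$ (with $a_i=0$ for $i<0$). $I_m$ is the identity matrix. -}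

module Defs where

open import Level using (0ℓ)
open import Algebra.Bundles using (CommutativeRing)
open import Data.Nat as ℕ using (ℕ; zero; suc; _≤_; _∸_)
open import Data.Nat.Properties using (≤-trans)
open import Data.Fin using (Fin; toℕ; fromℕ<)
open import Data.Fin.Properties using (_≟_)
open import Data.Integer as ℤ using (ℤ; +_)
open import Data.Rational as ℚ using (ℚ)
open import Relation.Nullary using (yes; no)

binomℚ : ℚ → ℕ → ℚ
binomℚ l zero    = ℚ.1ℚ
binomℚ l (suc k) = binomℚ l k ℚ.* ((l ℚ.- (+ k ℚ./ 1)) ℚ.* (+ 1 ℚ./ suc k))

-- the rational number (r - (i+1)) / r, for r ≥ 2   (i is 0-based, so this is (r-i')/r for i' = 1..m)
lamQ : (r : ℕ) → 2 ≤ r → ℕ → ℚ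
lamQ r@(suc r') _ i = (+ r ℤ.- + suc i) ℚ./ r

-- everything below takes place in a commutative ℚ-algebra A, given by a ring
-- homomorphism ι : ℚ → A, with elements s₁,…,s_r ∈ A (s (fromℕ< _) for index k+1)
module Setup (R : CommutativeRing 0ℓ 0ℓ) (ι : ℚ → CommutativeRing.Carrier R)
             (r : ℕ) (s : Fin r → CommutativeRing.Carrier R) where
  open CommutativeRing R renaming (Carrier to A)

  Series : Set
  Series = ℕ → A

  sumTo : ℕ → (ℕ → A) → A
  sumTo zero    f = 0#
  sumTo (suc n) f = sumTo n f + f n

  conv : Series → Series → Series
  conv f g n = sumTo (suc n) (λ k → f k * g (n ∸ k))

  φ : Series
  φ zero    = 1#
  φ (suc k) with k ℕ.<? r
  ... | yes k<r = s (fromℕ< k<r)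
  ... | no  _   = 0#

  u : Series
  u zero    = 0#
  u (suc k) = φ (suc k)

  one : Series
  one zero    = 1#
  one (suc _) = 0#

  upow : ℕ → Series
  upow zero    = one
  upow (suc k) = conv u (upow k)

  -- β_ℓ(λ) = coefficient of t^ℓ in φ(t)^λ = Σ_k binom(λ,k) u(t)^k  (binomial series), ℓ ≥ 0
  β : ℚ → ℕ → A
  β l ℓ = sumTo (suc ℓ) (λ k → ι (binomℚ l k) * upow k ℓ)

  alt : ℕ → A → A
  alt zero    x = x
  alt (suc k) x = - alt k x

  -- 1/φ(t) = Σ_k (-1)^k u(t)^k  (the multiplicative inverse of φ)
  invφ : Series
  invφ n = sumTo (suc n) (λ k → alt k (upow k n))

  tφ' : Series
  tφ' n = ι (+ n ℚ./ 1) * φ n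

  const : A → Series
  const c zero    = c
  const c (suc _) = 0#

  ψ : Series
  ψ n = const (ι (+ r ℚ./ 1)) n - conv tφ' invφ n

  Mat : ℕ → Set
  Mat m = Fin m → Fin m → A

  lowerAt : (ℕ → A) → ℕ → ℕ → A
  lowerAt f i j with j ℕ.≤? i
  ... | yes _ = f (i ∸ j)
  ... | no  _ = 0#

  P : (m : ℕ) → (Fin m → ℚ) → Mat m
  P m l i j = lowerAt (β (l i)) (toℕ i) (toℕ j)

  Q : (m : ℕ) → (Fin m → ℚ) → Mat m
  Q m μ i j = lowerAt (β (μ j)) (toℕ i) (toℕ j)

  S : (m : ℕ) → Series → Mat m
  S m f i j = lowerAt f (toℕ i) (toℕ j)

  sumFin : (n : ℕ) → (Fin n → A) → A
  sumFin zero    f = 0#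
  sumFin (suc n) f = f Fin.zero + sumFin n (λ i → f (Fin.suc i))
    where import Data.Fin as Fin

  _⊗_ : {m : ℕ} → Mat m → Mat m → Mat m
  _⊗_ {m} X Y i j = sumFin m (λ k → X i k * Y k j)

  diag : {m : ℕ} → (Fin m → A) → Mat m
  diag d i j with i ≟ j
  ... | yes _ = d i
  ... | no  _ = 0#

  scal : (m : ℕ) → A → Mat m
  scal m c = diag (λ _ → c)

  _≋_ : {m : ℕ} → Mat m → Mat m → Set
  X ≋ Y = ∀ i j → X i j ≈ Y i j

{-# OPTIONS --safe #-}
module Submission where

-- Write F_λ = φ^λ = Σ_k binom(λ,k) (φ - 1)^k and D = t d/dt.  Termwise differentiation and
-- (k+1) binom(λ,k+1) + k binom(λ,k) = λ binom(λ,k) give φ · D F_λ = λ F_λ Dφ, i.e. D F_λ = λ F_λ W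
-- with W = Dφ/φ.  Hence D(F_α F_γ) = (α + γ) F_α F_γ W, that is,
--   n [F_α F_γ]_n = (α + γ) [F_α F_γ W]_n   for every n.
-- Counting indices from 0, let λ_i = (r-1-i)/r and d_i = r-1-i.  Entry (i,j) of P S_m(ψ) Q is the
-- coefficient of t^(i-j) in F_α ψ F_γ = r F_α F_γ - F_α F_γ W with α = -λ_i, γ = λ_j; since
-- r(α + γ) = i - j, it is r for i = j and 0 for i > j.  In (ii), d_k = d_j - (k - j) turns entry (i,j)
-- into the coefficient of t^(i-j) in F_α (d_j F_γ - D F_γ) = d_j F_α F_γ - γ F_α F_γ W, and d_j = rγ.

open import Defs
open import Level using (0ℓ)
open import Algebra.Bundles using (CommutativeRing)
open import Algebra.Morphism.Structures using (IsRingHomomorphism)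
open import Data.Nat as ℕ using (ℕ; zero; suc; _≤_; _<_; _∸_; z≤n; s≤s)
import Data.Nat.Properties as ℕP
open import Data.Fin as Fin using (Fin; toℕ)
import Data.Fin.Properties as FinP
open import Data.Integer as ℤ using (ℤ; +_)
open import Data.Integer.Tactic.RingSolver using (solve-∀)
open import Data.Rational as ℚ using (ℚ)
import Data.Rational.Properties as ℚP
import Data.Rational.Unnormalised as ℚᵘ
import Data.Rational.Unnormalised.Properties as ℚᵘP
open import Data.Product using (_×_; _,_)
open import Data.Sum using (inj₁; inj₂)
open import Relation.Binary.Definitions using (tri<; tri≈; tri>)
open import Relation.Binary.PropositionalEquality as ≡ using (_≡_; _≢_)
open import Relation.Nullary using (yes; no)
open import Relation.Nullary.Negation using (contradiction)

module _ where
  open import Relation.Binary.Reasoning.Setoid ℚᵘP.≃-setoid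

  private
    toℚᵘ-/ : ∀ z k → ℚ.toℚᵘ (z ℚ./ suc k) ℚᵘ.≃ ℚᵘ.mkℚᵘ z k
    toℚᵘ-/ z k = ℚP.toℚᵘ-fromℚᵘ (ℚᵘ.mkℚᵘ z k)

  /1-homo-+ : ∀ x y → (x ℤ.+ y) ℚ./ 1 ≡ x ℚ./ 1 ℚ.+ y ℚ./ 1
  /1-homo-+ x y = ℚP.toℚᵘ-injective (begin
      ℚ.toℚᵘ ((x ℤ.+ y) ℚ./ 1)                ≈⟨ toℚᵘ-/ (x ℤ.+ y) 0 ⟩
      ℚᵘ.mkℚᵘ (x ℤ.+ y) 0                      ≈⟨ ℚᵘ.*≡* (numerators x y) ⟩
      ℚᵘ.mkℚᵘ x 0 ℚᵘ.+ ℚᵘ.mkℚᵘ y 0             ≈⟨ ℚᵘP.+-cong (toℚᵘ-/ x 0) (toℚᵘ-/ y 0) ⟨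
      ℚ.toℚᵘ (x ℚ./ 1) ℚᵘ.+ ℚ.toℚᵘ (y ℚ./ 1)   ≈⟨ ℚP.toℚᵘ-homo-+ (x ℚ./ 1) (y ℚ./ 1) ⟨
      ℚ.toℚᵘ (x ℚ./ 1 ℚ.+ y ℚ./ 1)             ∎)
    where
    numerators : ∀ x y → (x ℤ.+ y) ℤ.* + 1 ≡ (x ℤ.* + 1 ℤ.+ y ℤ.* + 1) ℤ.* + 1
    numerators = solve-∀

  /1-homo-neg : ∀ x → (ℤ.- x) ℚ./ 1 ≡ ℚ.- (x ℚ./ 1)
  /1-homo-neg x = ℚP.toℚᵘ-injective (begin
      ℚ.toℚᵘ ((ℤ.- x) ℚ./ 1)     ≈⟨ toℚᵘ-/ (ℤ.- x) 0 ⟩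
      ℚᵘ.- ℚᵘ.mkℚᵘ x 0           ≈⟨ ℚᵘP.-‿cong (toℚᵘ-/ x 0) ⟨
      ℚᵘ.- ℚ.toℚᵘ (x ℚ./ 1)      ≈⟨ ℚP.toℚᵘ-homo‿- (x ℚ./ 1) ⟨
      ℚ.toℚᵘ (ℚ.- (x ℚ./ 1))     ∎)

  /1-*-/-cancel : ∀ z k → (+ suc k ℚ./ 1) ℚ.* (z ℚ./ suc k) ≡ z ℚ./ 1
  /1-*-/-cancel z k = ℚP.toℚᵘ-injective (begin
      ℚ.toℚᵘ ((+ suc k ℚ./ 1) ℚ.* (z ℚ./ suc k))         ≈⟨ ℚP.toℚᵘ-homo-* (+ suc k ℚ./ 1) (z ℚ./ suc k) ⟩
      ℚ.toℚᵘ (+ suc k ℚ./ 1) ℚᵘ.* ℚ.toℚᵘ (z ℚ./ suc k)   ≈⟨ ℚᵘP.*-cong (toℚᵘ-/ (+ suc k) 0) (toℚᵘ-/ z k) ⟩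
      ℚᵘ.mkℚᵘ (+ suc k) 0 ℚᵘ.* ℚᵘ.mkℚᵘ z k                ≈⟨ ℚᵘ.*≡* cross ⟩
      ℚᵘ.mkℚᵘ z 0                                           ≈⟨ toℚᵘ-/ z 0 ⟨
      ℚ.toℚᵘ (z ℚ./ 1)                                      ∎)
    where
    swap : ∀ n z → (n ℤ.* z) ℤ.* + 1 ≡ z ℤ.* n
    swap = solve-∀
    cross : (+ suc k ℤ.* z) ℤ.* + 1 ≡ z ℤ.* + suc (k ℕ.+ 0)
    cross = ≡.trans (swap (+ suc k) z) (≡.cong (λ n → z ℤ.* + suc n) (≡.sym (ℕP.+-identityʳ k)))

module PowerSeries (R : CommutativeRing 0ℓ 0ℓ) (ι : ℚ → CommutativeRing.Carrier R)
                   (r : ℕ) (s : Fin r → CommutativeRing.Carrier R) where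
  open CommutativeRing R renaming (Carrier to A)
  open Setup R ι r s
  open import Algebra.Properties.Ring ring using (-0#≈0#; -‿+-comm; -‿distribʳ-*; -‿involutive)
  open import Algebra.Properties.CommutativeSemigroup +-commutativeSemigroup using (interchange)
  open import Algebra.Properties.CommutativeSemigroup *-commutativeSemigroup using (x∙yz≈y∙xz)
  open import Relation.Binary.Reasoning.Setoid setoid

  sumTo-cong : ∀ n {f g : ℕ → A} → (∀ k → k < n → f k ≈ g k) → sumTo n f ≈ sumTo n g
  sumTo-cong zero    f≈g = refl
  sumTo-cong (suc n) f≈g = +-cong (sumTo-cong n (λ k k<n → f≈g k (ℕP.m<n⇒m<1+n k<n))) (f≈g n ℕP.≤-refl)

  sumTo-zero : ∀ n {f : ℕ → A} → (∀ k → k < n → f k ≈ 0#) → sumTo n f ≈ 0#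
  sumTo-zero zero    f≈0 = refl
  sumTo-zero (suc n) f≈0 =
    trans (+-cong (sumTo-zero n (λ k k<n → f≈0 k (ℕP.m<n⇒m<1+n k<n))) (f≈0 n ℕP.≤-refl)) (+-identityʳ 0#)

  sumTo-+ : ∀ n (f g : ℕ → A) → sumTo n (λ k → f k + g k) ≈ sumTo n f + sumTo n g
  sumTo-+ zero    f g = sym (+-identityʳ 0#)
  sumTo-+ (suc n) f g = trans (+-cong (sumTo-+ n f g) refl) (interchange _ _ _ _)

  *-distribˡ-sumTo : ∀ n c (f : ℕ → A) → c * sumTo n f ≈ sumTo n (λ k → c * f k)
  *-distribˡ-sumTo zero    c f = zeroʳ c
  *-distribˡ-sumTo (suc n) c f = trans (distribˡ c _ _) (+-cong (*-distribˡ-sumTo n c f) refl)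

  *-distribʳ-sumTo : ∀ n c (f : ℕ → A) → sumTo n f * c ≈ sumTo n (λ k → f k * c)
  *-distribʳ-sumTo zero    c f = zeroˡ c
  *-distribʳ-sumTo (suc n) c f = trans (distribʳ c _ _) (+-cong (*-distribʳ-sumTo n c f) refl)

  -‿distrib-sumTo : ∀ n (f : ℕ → A) → - sumTo n f ≈ sumTo n (λ k → - f k)
  -‿distrib-sumTo zero    f = -0#≈0#
  -‿distrib-sumTo (suc n) f = trans (sym (-‿+-comm _ _)) (+-cong (-‿distrib-sumTo n f) refl)

  sumTo-uncons : ∀ n (f : ℕ → A) → sumTo (suc n) f ≈ f 0 + sumTo n (λ k → f (suc k))
  sumTo-uncons zero    f = trans (+-identityˡ _) (sym (+-identityʳ _))
  sumTo-uncons (suc n) f = trans (+-cong (sumTo-uncons n f) refl) (+-assoc _ _ _)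

  sumTo-comm : ∀ n m (f : ℕ → ℕ → A) →
               sumTo n (λ i → sumTo m (f i)) ≈ sumTo m (λ j → sumTo n (λ i → f i j))
  sumTo-comm zero    m f = sym (sumTo-zero m (λ _ _ → refl))
  sumTo-comm (suc n) m f = trans (+-cong (sumTo-comm n m f) refl) (sym (sumTo-+ m _ (f n)))

  sumTo-reverse : ∀ n (f : ℕ → A) → sumTo n f ≈ sumTo n (λ k → f (n ∸ suc k))
  sumTo-reverse zero    f = refl
  sumTo-reverse (suc n) f =
    trans (+-comm _ _) (trans (+-cong refl (sumTo-reverse n f)) (sym (sumTo-uncons n (λ k → f (n ∸ k)))))

  sumTo-vanishing-tail : ∀ {n} N {f : ℕ → A} → n ≤ N → (∀ k → n ≤ k → k < N → f k ≈ 0#) →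
                         sumTo N f ≈ sumTo n f
  sumTo-vanishing-tail zero    z≤n   _      = refl
  sumTo-vanishing-tail (suc N) n≤1+N vanish with ℕP.m≤n⇒m<n∨m≡n n≤1+N
  ... | inj₂ ≡.refl      = refl
  ... | inj₁ (s≤s n≤N) =
    trans (+-cong (sumTo-vanishing-tail N n≤N (λ k n≤k k<N → vanish k n≤k (ℕP.m<n⇒m<1+n k<N)))
                  (vanish N n≤N ℕP.≤-refl))
          (+-identityʳ _)

  sumTo-vanishing-head : ∀ a n {f : ℕ → A} → (∀ k → k < a → f k ≈ 0#) →
                         sumTo (a ℕ.+ n) f ≈ sumTo n (λ q → f (a ℕ.+ q))
  sumTo-vanishing-head a zero    {f} vanish =
    trans (reflexive (≡.cong (λ N → sumTo N f) (ℕP.+-identityʳ a))) (sumTo-zero a vanish)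
  sumTo-vanishing-head a (suc n) {f} vanish =
    trans (reflexive (≡.cong (λ N → sumTo N f) (ℕP.+-suc a n))) (+-cong (sumTo-vanishing-head a n vanish) refl)

  lowerAt-≤ : ∀ (f : Series) {i j} → j ≤ i → lowerAt f i j ≈ f (i ∸ j)
  lowerAt-≤ f {i} {j} j≤i with j ℕ.≤? i
  ... | yes _   = refl
  ... | no  j≰i = contradiction j≤i j≰i

  lowerAt-> : ∀ (f : Series) {i j} → i < j → lowerAt f i j ≈ 0#
  lowerAt-> f {i} {j} i<j with j ℕ.≤? i
  ... | yes j≤i = contradiction j≤i (ℕP.<⇒≱ i<j)
  ... | no  _   = refl

  infix 4 _≈ₛ_
  _≈ₛ_ : Series → Series → Set
  f ≈ₛ g = ∀ n → f n ≈ g n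

  infixl 6 _+ₛ_
  _+ₛ_ : Series → Series → Series
  (f +ₛ g) n = f n + g n

  -ₛ_ : Series → Series
  (-ₛ f) n = - f n

  infixr 7 _•_
  _•_ : A → Series → Series
  (c • f) n = c * f n

  0ₛ : Series
  0ₛ _ = 0#

  conv-cong : ∀ {f f′ g g′} → f ≈ₛ f′ → g ≈ₛ g′ → conv f g ≈ₛ conv f′ g′
  conv-cong f≈f′ g≈g′ n = sumTo-cong (suc n) (λ k _ → *-cong (f≈f′ k) (g≈g′ (n ∸ k)))

  conv-congˡ : ∀ {f g g′} → g ≈ₛ g′ → conv f g ≈ₛ conv f g′
  conv-congˡ = conv-cong (λ _ → refl)

  conv-congʳ : ∀ {f f′ g} → f ≈ₛ f′ → conv f g ≈ₛ conv f′ g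
  conv-congʳ {g = g} f≈f′ = conv-cong {g = g} f≈f′ (λ _ → refl)

  conv-0 : ∀ f g → conv f g 0 ≈ f 0 * g 0
  conv-0 f g = +-identityˡ _

  conv-comm : ∀ f g → conv f g ≈ₛ conv g f
  conv-comm f g n = trans (sumTo-reverse (suc n) _) (sumTo-cong (suc n) λ k k≤n →
    trans (reflexive (≡.cong (λ x → f (n ∸ k) * g x) (ℕP.m∸[m∸n]≡n (ℕP.≤-pred k≤n)))) (*-comm _ _))

  -- Row i of the Toeplitz matrix of F times column k of that of H is entry (i, k) of the Toeplitz
  -- matrix of F H.  Only row i of the first matrix enters, so F may change from row to row.
  sumTo-lowerAt-conv-truncated : ∀ F H i k →
    sumTo (suc i) (λ l → lowerAt F i l * lowerAt H l k) ≈ lowerAt (conv F H) i k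
  sumTo-lowerAt-conv-truncated F H i k with i ℕ.<? k
  ... | yes i<k =
    trans (sumTo-zero (suc i) (λ l l≤i → trans (*-cong refl (lowerAt-> H (ℕP.<-≤-trans l≤i i<k))) (zeroʳ _)))
          (sym (lowerAt-> (conv F H) i<k))
  ... | no i≮k = begin
      sumTo (suc i) X                          ≡⟨ ≡.cong (λ M → sumTo M X) split ⟩
      sumTo (k ℕ.+ suc n) X                    ≈⟨ sumTo-vanishing-head k (suc n) below-k ⟩
      sumTo (suc n) (λ q → X (k ℕ.+ q))        ≈⟨ sumTo-cong (suc n) shifted ⟩
      sumTo (suc n) (λ q → H q * F (n ∸ q))    ≈⟨ conv-comm H F n ⟩
      conv F H n                               ≈⟨ lowerAt-≤ (conv F H) k≤i ⟨
      lowerAt (conv F H) i k                   ∎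
    where
    k≤i : k ≤ i
    k≤i = ℕP.≮⇒≥ i≮k
    n : ℕ
    n = i ∸ k
    X : ℕ → A
    X l = lowerAt F i l * lowerAt H l k
    split : suc i ≡ k ℕ.+ suc n
    split = ≡.trans (≡.cong suc (≡.sym (ℕP.m+[n∸m]≡n k≤i))) (≡.sym (ℕP.+-suc k n))
    below-k : ∀ l → l < k → X l ≈ 0#
    below-k l l<k = trans (*-cong refl (lowerAt-> H l<k)) (zeroʳ _)
    shifted : ∀ q → q < suc n → X (k ℕ.+ q) ≈ H q * F (n ∸ q)
    shifted q q≤n = trans (*-cong F-entry H-entry) (*-comm _ _)
      where
      k+q≤i : k ℕ.+ q ≤ i
      k+q≤i = ≡.subst (k ℕ.+ q ≤_) (ℕP.m+[n∸m]≡n k≤i) (ℕP.+-monoʳ-≤ k (ℕP.≤-pred q≤n))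
      F-entry : lowerAt F i (k ℕ.+ q) ≈ F (n ∸ q)
      F-entry = trans (lowerAt-≤ F k+q≤i) (reflexive (≡.cong F (≡.sym (ℕP.∸-+-assoc i k q))))
      H-entry : lowerAt H (k ℕ.+ q) k ≈ H q
      H-entry = trans (lowerAt-≤ H (ℕP.m≤m+n k q)) (reflexive (≡.cong H (ℕP.m+n∸m≡n k q)))

  sumTo-lowerAt-conv : ∀ N F H {i} k → i < N →
    sumTo N (λ l → lowerAt F i l * lowerAt H l k) ≈ lowerAt (conv F H) i k
  sumTo-lowerAt-conv N F H {i} k i<N =
    trans (sumTo-vanishing-tail N i<N (λ l i<l _ → trans (*-cong (lowerAt-> F i<l) refl) (zeroˡ _)))
          (sumTo-lowerAt-conv-truncated F H i k)

  conv-assoc : ∀ f g h → conv (conv f g) h ≈ₛ conv f (conv g h)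
  conv-assoc f g h n = begin
      sumTo (suc n) (λ c → conv f g c * h (n ∸ c))
    ≈⟨ sumTo-cong (suc n) (λ c c≤n → trans (*-cong (fg-as-sum c≤n) refl) (*-distribʳ-sumTo (suc n) _ _)) ⟩
      sumTo (suc n) (λ c → sumTo (suc n) (λ a → (f a * lowerAt g c a) * h (n ∸ c)))
    ≈⟨ sumTo-comm (suc n) (suc n) _ ⟩
      sumTo (suc n) (λ a → sumTo (suc n) (λ c → (f a * lowerAt g c a) * h (n ∸ c)))
    ≈⟨ sumTo-cong (suc n) (λ a _ → trans (sumTo-cong (suc n) (λ c _ → *-assoc _ _ _))
                                          (sym (*-distribˡ-sumTo (suc n) _ _))) ⟩
      sumTo (suc n) (λ a → f a * sumTo (suc n) (λ c → lowerAt g c a * h (n ∸ c)))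
    ≈⟨ sumTo-cong (suc n) (λ a a≤n → *-cong refl (gh-as-sum (ℕP.≤-pred a≤n))) ⟩
      sumTo (suc n) (λ a → f a * conv g h (n ∸ a))
    ∎
    where
    fg-as-sum : ∀ {c} → c < suc n → conv f g c ≈ sumTo (suc n) (λ a → f a * lowerAt g c a)
    fg-as-sum {c} c≤n = begin
      conv f g c                                              ≈⟨ conv-comm f g c ⟩
      conv g f c                                              ≈⟨ sumTo-lowerAt-conv (suc n) g f 0 c≤n ⟨
      sumTo (suc n) (λ a → lowerAt g c a * lowerAt f a 0)     ≈⟨ sumTo-cong (suc n) (λ a _ → trans (*-comm _ _)
                                                                                     (*-cong (lowerAt-≤ f z≤n) refl)) ⟩
      sumTo (suc n) (λ a → f a * lowerAt g c a)               ∎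
    gh-as-sum : ∀ {a} → a ≤ n → sumTo (suc n) (λ c → lowerAt g c a * h (n ∸ c)) ≈ conv g h (n ∸ a)
    gh-as-sum {a} a≤n = begin
      sumTo (suc n) (λ c → lowerAt g c a * h (n ∸ c))         ≈⟨ sumTo-cong (suc n) (λ c c≤n → trans (*-comm _ _)
                                                                   (*-cong (sym (lowerAt-≤ h (ℕP.≤-pred c≤n))) refl)) ⟩
      sumTo (suc n) (λ c → lowerAt h n c * lowerAt g c a)     ≈⟨ sumTo-lowerAt-conv-truncated h g n a ⟩
      lowerAt (conv h g) n a                                   ≈⟨ lowerAt-≤ (conv h g) a≤n ⟩
      conv h g (n ∸ a)                                         ≈⟨ conv-comm h g (n ∸ a) ⟩
      conv g h (n ∸ a)                                         ∎

  conv-distribˡ : ∀ f g h → conv f (g +ₛ h) ≈ₛ conv f g +ₛ conv f h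
  conv-distribˡ f g h n = trans (sumTo-cong (suc n) (λ k _ → distribˡ _ _ _)) (sumTo-+ (suc n) _ _)

  conv-distribʳ : ∀ f g h → conv (f +ₛ g) h ≈ₛ conv f h +ₛ conv g h
  conv-distribʳ f g h n = trans (sumTo-cong (suc n) (λ k _ → distribʳ _ _ _)) (sumTo-+ (suc n) _ _)

  conv-negʳ : ∀ f g → conv f (-ₛ g) ≈ₛ -ₛ conv f g
  conv-negʳ f g n = trans (sumTo-cong (suc n) (λ k _ → sym (-‿distribʳ-* _ _))) (sym (-‿distrib-sumTo (suc n) _))

  conv-•ˡ : ∀ c f g → conv (c • f) g ≈ₛ c • conv f g
  conv-•ˡ c f g n = trans (sumTo-cong (suc n) (λ k _ → *-assoc _ _ _)) (sym (*-distribˡ-sumTo (suc n) c _))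

  conv-•ʳ : ∀ c f g → conv f (c • g) ≈ₛ c • conv f g
  conv-•ʳ c f g n = trans (sumTo-cong (suc n) (λ k _ → x∙yz≈y∙xz _ _ _)) (sym (*-distribˡ-sumTo (suc n) c _))

  conv-zeroʳ : ∀ f → conv f 0ₛ ≈ₛ 0ₛ
  conv-zeroʳ f n = sumTo-zero (suc n) (λ k _ → zeroʳ _)

  conv-identityˡ : ∀ f → conv one f ≈ₛ f
  conv-identityˡ f n =
    trans (sumTo-uncons n _) (trans (+-cong (*-identityˡ _) (sumTo-zero n (λ k _ → zeroˡ _))) (+-identityʳ _))

  conv-identityʳ : ∀ f → conv f one ≈ₛ f
  conv-identityʳ f n = trans (conv-comm f one n) (conv-identityˡ f n)

  t^_∣_ : ℕ → Series → Set
  t^ k ∣ f = ∀ n → n < k → f n ≈ 0#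

  t^∣-conv : ∀ {a b f g} → t^ a ∣ f → t^ b ∣ g → t^ (a ℕ.+ b) ∣ conv f g
  t^∣-conv {a} {b} {f} {g} a∣f b∣g n n<a+b = sumTo-zero (suc n) term
    where
    term : ∀ k → k < suc n → f k * g (n ∸ k) ≈ 0#
    term k k≤n with k ℕ.<? a
    ... | yes k<a = trans (*-cong (a∣f k k<a) refl) (zeroˡ _)
    ... | no  k≮a = trans (*-cong refl (b∣g (n ∸ k) n∸k<b)) (zeroʳ _)
      where
      n∸k<b : n ∸ k < b
      n∸k<b = ℕP.+-cancelˡ-< k _ _
        (≡.subst (_< k ℕ.+ b) (≡.sym (ℕP.m+[n∸m]≡n (ℕP.≤-pred k≤n)))
                 (ℕP.<-≤-trans n<a+b (ℕP.+-monoˡ-≤ b (ℕP.≮⇒≥ k≮a))))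

  t∣u : t^ 1 ∣ u
  t∣u zero    _ = refl
  t∣u (suc n) (s≤s ())

  t^k∣upow : ∀ k → t^ k ∣ upow k
  t^k∣upow zero    _ ()
  t^k∣upow (suc k) = t^∣-conv t∣u (t^k∣upow k)

  t^∣-• : ∀ {k} c {f} → t^ k ∣ f → t^ k ∣ (c • f)
  t^∣-• c k∣f n n<k = trans (*-cong refl (k∣f n n<k)) (zeroʳ c)

  -- The formal sum of a family with t^k ∣ F k: coefficient n needs only F 0, …, F n.
  ∑ₛ : (ℕ → Series) → Series
  ∑ₛ F n = sumTo (suc n) (λ k → F k n)

  ∑ₛ-cong : ∀ {F G} → (∀ k → F k ≈ₛ G k) → ∑ₛ F ≈ₛ ∑ₛ G
  ∑ₛ-cong F≈G n = sumTo-cong (suc n) (λ k _ → F≈G k n)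

  ∑ₛ-+ₛ : ∀ F G → ∑ₛ (λ k → F k +ₛ G k) ≈ₛ ∑ₛ F +ₛ ∑ₛ G
  ∑ₛ-+ₛ F G n = sumTo-+ (suc n) _ _

  ∑ₛ-neg : ∀ F → ∑ₛ (λ k → -ₛ F k) ≈ₛ -ₛ ∑ₛ F
  ∑ₛ-neg F n = sym (-‿distrib-sumTo (suc n) _)

  ∑ₛ-• : ∀ c F → ∑ₛ (λ k → c • F k) ≈ₛ c • ∑ₛ F
  ∑ₛ-• c F n = sym (*-distribˡ-sumTo (suc n) c _)

  ∑ₛ-uncons : ∀ F → (∀ k → t^ k ∣ F k) → ∑ₛ F ≈ₛ F 0 +ₛ ∑ₛ (λ k → F (suc k))
  ∑ₛ-uncons F k∣F n =
    trans (sumTo-uncons n _) (+-cong refl (sym (trans (+-cong refl (k∣F (suc n) n ℕP.≤-refl)) (+-identityʳ _))))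

  conv-∑ₛ : ∀ g F → (∀ k → t^ k ∣ F k) → conv g (∑ₛ F) ≈ₛ ∑ₛ (λ k → conv g (F k))
  conv-∑ₛ g F k∣F n = begin
      sumTo (suc n) (λ j → g j * sumTo (suc (n ∸ j)) (λ k → F k (n ∸ j)))
    ≈⟨ sumTo-cong (suc n) (λ j _ → *-cong refl (sym (sumTo-vanishing-tail (suc n) (s≤s (ℕP.m∸n≤m n j))
                                                       (λ k n∸j<k _ → k∣F k (n ∸ j) n∸j<k)))) ⟩
      sumTo (suc n) (λ j → g j * sumTo (suc n) (λ k → F k (n ∸ j)))
    ≈⟨ sumTo-cong (suc n) (λ j _ → *-distribˡ-sumTo (suc n) (g j) _) ⟩
      sumTo (suc n) (λ j → sumTo (suc n) (λ k → g j * F k (n ∸ j)))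
    ≈⟨ sumTo-comm (suc n) (suc n) _ ⟩
      sumTo (suc n) (λ k → sumTo (suc n) (λ j → g j * F k (n ∸ j)))
    ∎

  φ≈one+u : φ ≈ₛ one +ₛ u
  φ≈one+u zero    = sym (+-identityʳ _)
  φ≈one+u (suc n) = sym (+-identityˡ _)

  alt-cong : ∀ k {x y} → x ≈ y → alt k x ≈ alt k y
  alt-cong zero    x≈y = x≈y
  alt-cong (suc k) x≈y = -‿cong (alt-cong k x≈y)

  alt-zero : ∀ k → alt k 0# ≈ 0#
  alt-zero zero    = refl
  alt-zero (suc k) = trans (-‿cong (alt-zero k)) -0#≈0#

  *-alt : ∀ k y x → y * alt k x ≈ alt k (y * x)
  *-alt zero    y x = refl
  *-alt (suc k) y x = trans (sym (-‿distribʳ-* y (alt k x))) (-‿cong (*-alt k y x))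

  sumTo-alt : ∀ k n (f : ℕ → A) → sumTo n (λ i → alt k (f i)) ≈ alt k (sumTo n f)
  sumTo-alt zero    n f = refl
  sumTo-alt (suc k) n f = trans (sym (-‿distrib-sumTo n _)) (-‿cong (sumTo-alt k n f))

  invφ*φ≈one : conv invφ φ ≈ₛ one
  invφ*φ≈one n = begin
      conv invφ φ n
    ≈⟨ trans (conv-comm invφ φ n) (conv-congʳ {g = ∑ₛ term} φ≈one+u n) ⟩
      conv (one +ₛ u) (∑ₛ term) n
    ≈⟨ conv-distribʳ one u (∑ₛ term) n ⟩
      conv one (∑ₛ term) n + conv u (∑ₛ term) n
    ≈⟨ +-cong (trans (conv-identityˡ (∑ₛ term) n) (∑ₛ-uncons term t^k∣term n))
              (trans (conv-∑ₛ u term t^k∣term n) (trans (∑ₛ-cong u*term n) (∑ₛ-neg tail n))) ⟩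
      (one n + ∑ₛ tail n) + - ∑ₛ tail n
    ≈⟨ trans (+-assoc _ _ _) (trans (+-cong refl (-‿inverseʳ _)) (+-identityʳ _)) ⟩
      one n
    ∎
    where
    term tail : ℕ → Series
    term k n = alt k (upow k n)
    tail k   = term (suc k)
    t^k∣term : ∀ k → t^ k ∣ term k
    t^k∣term k n n<k = trans (alt-cong k (t^k∣upow k n n<k)) (alt-zero k)
    u*term : ∀ k → conv u (term k) ≈ₛ -ₛ term (suc k)
    u*term k n = trans (sumTo-cong (suc n) (λ i _ → *-alt k _ _))
                       (trans (sumTo-alt k (suc n) _) (sym (-‿involutive _)))

module EulerOperator (R : CommutativeRing 0ℓ 0ℓ) (ι : ℚ → CommutativeRing.Carrier R)
                     (hom : IsRingHomomorphism ℚ.+-*-rawRing (CommutativeRing.rawRing R) ι)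
                     (r : ℕ) (s : Fin r → CommutativeRing.Carrier R) where
  open CommutativeRing R renaming (Carrier to A)
  open Setup R ι r s
  open PowerSeries R ι r s
  open IsRingHomomorphism hom using (+-homo; *-homo; -‿homo; 0#-homo; 1#-homo)
  open import Algebra.Properties.Ring ring using (-0#≈0#)
  open import Algebra.Properties.CommutativeSemigroup *-commutativeSemigroup using (x∙yz≈y∙xz)
  open import Relation.Binary.Reasoning.Setoid setoid

  ιℤ : ℤ → A
  ιℤ z = ι (z ℚ./ 1)

  ιℤ-+ : ∀ x y → ιℤ (x ℤ.+ y) ≈ ιℤ x + ιℤ y
  ιℤ-+ x y = trans (reflexive (≡.cong ι (/1-homo-+ x y))) (+-homo _ _)

  ιℤ-neg : ∀ x → ιℤ (ℤ.- x) ≈ - ιℤ x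
  ιℤ-neg x = trans (reflexive (≡.cong ι (/1-homo-neg x))) (-‿homo _)

  ιℤ-‿ : ∀ x y → ιℤ (x ℤ.- y) ≈ ιℤ x - ιℤ y
  ιℤ-‿ x y = trans (ιℤ-+ x (ℤ.- y)) (+-cong refl (ιℤ-neg y))

  ιℕ : ℕ → A
  ιℕ n = ιℤ (+ n)

  ιℕ-+ : ∀ a b → ιℕ (a ℕ.+ b) ≈ ιℕ a + ιℕ b
  ιℕ-+ a b = ιℤ-+ (+ a) (+ b)

  ι[1/1+k]*ιℕ[1+k] : ∀ k → ι (+ 1 ℚ./ suc k) * ιℕ (suc k) ≈ 1#
  ι[1/1+k]*ιℕ[1+k] k = trans (sym (*-homo _ _)) (trans (reflexive (≡.cong ι 1/[1+k]*[1+k]≡1)) 1#-homo)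
    where
    1/[1+k]*[1+k]≡1 : (+ 1 ℚ./ suc k) ℚ.* (+ suc k ℚ./ 1) ≡ ℚ.1ℚ
    1/[1+k]*[1+k]≡1 = ≡.trans (ℚP.*-comm (+ 1 ℚ./ suc k) (+ suc k ℚ./ 1)) (/1-*-/-cancel (+ 1) k)

  ιℕ-suc-cancelˡ : ∀ n {x y} → ιℕ (suc n) * x ≈ ιℕ (suc n) * y → x ≈ y
  ιℕ-suc-cancelˡ n {x} {y} eq = begin
    x                                     ≈⟨ *-identityˡ x ⟨
    1# * x                                ≈⟨ *-cong (ι[1/1+k]*ιℕ[1+k] n) refl ⟨
    (ι (+ 1 ℚ./ suc n) * ιℕ (suc n)) * x  ≈⟨ *-assoc _ _ _ ⟩
    ι (+ 1 ℚ./ suc n) * (ιℕ (suc n) * x)  ≈⟨ *-cong refl eq ⟩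
    ι (+ 1 ℚ./ suc n) * (ιℕ (suc n) * y)  ≈⟨ *-assoc _ _ _ ⟨
    (ι (+ 1 ℚ./ suc n) * ιℕ (suc n)) * y  ≈⟨ *-cong (ι[1/1+k]*ιℕ[1+k] n) refl ⟩
    1# * y                                ≈⟨ *-identityˡ y ⟩
    y                                     ∎

  D : Series → Series
  D f n = ιℕ n * f n

  D-• : ∀ c f → D (c • f) ≈ₛ c • D f
  D-• c f n = x∙yz≈y∙xz (ιℕ n) c (f n)

  D-∑ₛ : ∀ F → D (∑ₛ F) ≈ₛ ∑ₛ (λ k → D (F k))
  D-∑ₛ F n = *-distribˡ-sumTo (suc n) (ιℕ n) _

  t^∣-D : ∀ {k f} → t^ k ∣ f → t^ k ∣ D f
  t^∣-D k∣f n n<k = trans (*-cong refl (k∣f n n<k)) (zeroʳ _)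

  D-one : D one ≈ₛ 0ₛ
  D-one zero    = trans (*-cong 0#-homo refl) (zeroˡ _)
  D-one (suc n) = zeroʳ _

  Dφ≈Du : D φ ≈ₛ D u
  Dφ≈Du zero    = trans (*-cong 0#-homo refl) (trans (zeroˡ _) (sym (zeroʳ _)))
  Dφ≈Du (suc n) = refl

  D-conv : ∀ f g → D (conv f g) ≈ₛ conv (D f) g +ₛ conv f (D g)
  D-conv f g n = begin
      ιℕ n * sumTo (suc n) (λ k → f k * g (n ∸ k))
    ≈⟨ *-distribˡ-sumTo (suc n) (ιℕ n) _ ⟩
      sumTo (suc n) (λ k → ιℕ n * (f k * g (n ∸ k)))
    ≈⟨ sumTo-cong (suc n) leibniz ⟩
      sumTo (suc n) (λ k → (ιℕ k * f k) * g (n ∸ k) + f k * (ιℕ (n ∸ k) * g (n ∸ k)))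
    ≈⟨ sumTo-+ (suc n) _ _ ⟩
      conv (D f) g n + conv f (D g) n
    ∎
    where
    leibniz : ∀ k → k < suc n →
              ιℕ n * (f k * g (n ∸ k)) ≈ (ιℕ k * f k) * g (n ∸ k) + f k * (ιℕ (n ∸ k) * g (n ∸ k))
    leibniz k k≤n = begin
        ιℕ n * (f k * g (n ∸ k))
      ≡⟨ ≡.cong (λ m → ιℕ m * (f k * g (n ∸ k))) (≡.sym (ℕP.m+[n∸m]≡n (ℕP.≤-pred k≤n))) ⟩
        ιℕ (k ℕ.+ (n ∸ k)) * (f k * g (n ∸ k))
      ≈⟨ trans (*-cong (ιℕ-+ k (n ∸ k)) refl) (distribʳ _ _ _) ⟩
        ιℕ k * (f k * g (n ∸ k)) + ιℕ (n ∸ k) * (f k * g (n ∸ k))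
      ≈⟨ +-cong (sym (*-assoc _ _ _)) (x∙yz≈y∙xz _ _ _) ⟩
        (ιℕ k * f k) * g (n ∸ k) + f k * (ιℕ (n ∸ k) * g (n ∸ k))
      ∎

  D-upow : ∀ k → D (upow (suc k)) ≈ₛ ιℕ (suc k) • conv (upow k) (D u)
  D-upow zero n = begin
    D (conv u one) n                       ≈⟨ D-conv u one n ⟩
    conv (D u) one n + conv u (D one) n    ≈⟨ +-cong (conv-identityʳ (D u) n)
                                                     (trans (conv-congˡ D-one n) (conv-zeroʳ u n)) ⟩
    D u n + 0#                             ≈⟨ +-identityʳ _ ⟩
    D u n                                  ≈⟨ trans (*-cong 1#-homo (conv-identityˡ (D u) n)) (*-identityˡ _) ⟨
    ιℕ 1 * conv one (D u) n                ∎
  D-upow (suc k) n = begin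
      D (conv u (upow (suc k))) n
    ≈⟨ D-conv u (upow (suc k)) n ⟩
      conv (D u) (upow (suc k)) n + conv u (D (upow (suc k))) n
    ≈⟨ +-cong (conv-comm (D u) _ n) (trans (conv-congˡ (D-upow k) n) (conv-•ʳ (ιℕ (suc k)) u (V k) n)) ⟩
      V (suc k) n + ιℕ (suc k) * conv u (V k) n
    ≈⟨ +-cong (sym (*-identityˡ _)) (*-cong refl (sym (conv-assoc u (upow k) (D u) n))) ⟩
      1# * V (suc k) n + ιℕ (suc k) * V (suc k) n
    ≈⟨ distribʳ _ _ _ ⟨
      (1# + ιℕ (suc k)) * V (suc k) n
    ≈⟨ *-cong (trans (ιℕ-+ 1 (suc k)) (+-cong 1#-homo refl)) refl ⟨
      ιℕ (suc (suc k)) * V (suc k) n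
    ∎
    where
    V : ℕ → Series
    V k = conv (upow k) (D u)

  binomℚ-recurrence : ∀ α k → ι (binomℚ α (suc k)) * ιℕ (suc k) ≈ (ι α - ιℕ k) * ι (binomℚ α k)
  binomℚ-recurrence α k = begin
      ι (binomℚ α k ℚ.* ((α ℚ.- (+ k ℚ./ 1)) ℚ.* (+ 1 ℚ./ suc k))) * ιℕ (suc k)
    ≈⟨ *-cong (trans (*-homo _ _) (*-cong refl (trans (*-homo _ _) (*-cong ι[α-k] refl)))) refl ⟩
      (b * ((ι α - ιℕ k) * w)) * ιℕ (suc k)
    ≈⟨ trans (*-cong (x∙yz≈y∙xz _ _ _) refl) (*-assoc _ _ _) ⟩
      (ι α - ιℕ k) * ((b * w) * ιℕ (suc k))
    ≈⟨ *-cong refl (trans (*-assoc _ _ _) (trans (*-cong refl (ι[1/1+k]*ιℕ[1+k] k)) (*-identityʳ b))) ⟩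
      (ι α - ιℕ k) * b
    ∎
    where
    b w : A
    b = ι (binomℚ α k)
    w = ι (+ 1 ℚ./ suc k)
    ι[α-k] : ι (α ℚ.- (+ k ℚ./ 1)) ≈ ι α - ιℕ k
    ι[α-k] = trans (+-homo _ _) (+-cong refl (-‿homo _))

  module BinomialSeries (α : ℚ) where
    private
      b : ℕ → A
      b k = ι (binomℚ α k)

      term : ℕ → Series
      term k = b k • upow k

      V : ℕ → Series
      V k = conv (upow k) (D u)

      t^k∣term : ∀ k → t^ k ∣ term k
      t^k∣term k = t^∣-• (b k) (t^k∣upow k)

      t^k∣D-term : ∀ k → t^ k ∣ D (term k)
      t^k∣D-term k = t^∣-D (t^k∣term k)

      D-term-zero : D (term 0) ≈ₛ 0ₛ
      D-term-zero n = trans (D-• (b 0) one n) (trans (*-cong refl (D-one n)) (zeroʳ _))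

      D-term-suc : ∀ k → D (term (suc k)) ≈ₛ (b (suc k) * ιℕ (suc k)) • V k
      D-term-suc k n = trans (D-• (b (suc k)) (upow (suc k)) n) (trans (*-cong refl (D-upow k n)) (sym (*-assoc _ _ _)))

      u*D-term : ∀ k → conv u (D (term k)) ≈ₛ (ιℕ k * b k) • V k
      u*D-term zero n = begin
        conv u (D (term 0)) n   ≈⟨ trans (conv-congˡ D-term-zero n) (conv-zeroʳ u n) ⟩
        0#                      ≈⟨ trans (*-cong (trans (*-cong 0#-homo refl) (zeroˡ _)) refl) (zeroˡ _) ⟨
        (ιℕ 0 * b 0) * V 0 n    ∎
      u*D-term (suc k) n = begin
        conv u (D (term (suc k))) n                 ≈⟨ conv-congˡ (D-term-suc k) n ⟩
        conv u ((b (suc k) * ιℕ (suc k)) • V k) n   ≈⟨ conv-•ʳ _ u (V k) n ⟩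
        (b (suc k) * ιℕ (suc k)) * conv u (V k) n   ≈⟨ *-cong (*-comm _ _) (sym (conv-assoc u (upow k) (D u) n)) ⟩
        (ιℕ (suc k) * b (suc k)) * V (suc k) n      ∎

      D-term-recurrence : ∀ k → D (term (suc k)) +ₛ conv u (D (term k)) ≈ₛ (ι α * b k) • V k
      D-term-recurrence k n = begin
          D (term (suc k)) n + conv u (D (term k)) n
        ≈⟨ +-cong (D-term-suc k n) (u*D-term k n) ⟩
          (b (suc k) * ιℕ (suc k)) * V k n + (ιℕ k * b k) * V k n
        ≈⟨ +-cong (*-cong (binomℚ-recurrence α k) refl) refl ⟩
          ((ι α - ιℕ k) * b k) * V k n + (ιℕ k * b k) * V k n
        ≈⟨ trans (sym (distribʳ _ _ _)) (*-cong (sym (distribʳ _ _ _)) refl) ⟩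
          ((ι α - ιℕ k + ιℕ k) * b k) * V k n
        ≈⟨ *-cong (*-cong (trans (+-assoc _ _ _) (trans (+-cong refl (-‿inverseˡ _)) (+-identityʳ _))) refl) refl ⟩
          (ι α * b k) * V k n
        ∎

    φ*Dβ≈α•β*Dφ : conv φ (D (β α)) ≈ₛ ι α • conv (β α) (D φ)
    φ*Dβ≈α•β*Dφ n = begin
        conv φ (D (∑ₛ term)) n
      ≈⟨ trans (conv-cong φ≈one+u (D-∑ₛ term) n) (conv-distribʳ one u (∑ₛ DT) n) ⟩
        conv one (∑ₛ DT) n + conv u (∑ₛ DT) n
      ≈⟨ +-cong (trans (conv-identityˡ (∑ₛ DT) n) (∑ₛ-uncons DT t^k∣D-term n)) (conv-∑ₛ u DT t^k∣D-term n) ⟩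
        (DT 0 n + ∑ₛ (λ k → DT (suc k)) n) + ∑ₛ (λ k → conv u (DT k)) n
      ≈⟨ +-cong (trans (+-cong (D-term-zero n) refl) (+-identityˡ _)) refl ⟩
        ∑ₛ (λ k → DT (suc k)) n + ∑ₛ (λ k → conv u (DT k)) n
      ≈⟨ ∑ₛ-+ₛ (λ k → DT (suc k)) (λ k → conv u (DT k)) n ⟨
        ∑ₛ (λ k → DT (suc k) +ₛ conv u (DT k)) n
      ≈⟨ ∑ₛ-cong D-term-recurrence n ⟩
        ∑ₛ (λ k → (ι α * b k) • V k) n
      ≈⟨ ∑ₛ-cong (λ k m → trans (*-assoc _ _ _) (*-cong refl (sym (conv-•ˡ (b k) (upow k) (D u) m)))) n ⟩
        ∑ₛ (λ k → ι α • conv (term k) (D u)) n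
      ≈⟨ ∑ₛ-• (ι α) (λ k → conv (term k) (D u)) n ⟩
        ι α * ∑ₛ (λ k → conv (term k) (D u)) n
      ≈⟨ *-cong refl (trans (∑ₛ-cong (λ k → conv-comm (term k) (D u)) n) (sym (conv-∑ₛ (D u) term t^k∣term n))) ⟩
        ι α * conv (D u) (∑ₛ term) n
      ≈⟨ *-cong refl (trans (conv-comm (D u) _ n) (conv-congˡ (λ m → sym (Dφ≈Du m)) n)) ⟩
        ι α * conv (∑ₛ term) (D φ) n
      ∎
      where
      DT : ℕ → Series
      DT k = D (term k)

  Dlogφ : Series
  Dlogφ = conv (D φ) invφ

  Dlogφ-0 : Dlogφ 0 ≈ 0#
  Dlogφ-0 = trans (conv-0 (D φ) invφ) (trans (*-cong (D-one 0) refl) (zeroˡ _))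

  D-β : ∀ α → D (β α) ≈ₛ ι α • conv (β α) Dlogφ
  D-β α n = begin
    D F n                               ≈⟨ conv-identityˡ (D F) n ⟨
    conv one (D F) n                    ≈⟨ conv-congʳ {g = D F} (λ m → sym (invφ*φ≈one m)) n ⟩
    conv (conv invφ φ) (D F) n          ≈⟨ conv-assoc invφ φ (D F) n ⟩
    conv invφ (conv φ (D F)) n          ≈⟨ conv-congˡ (BinomialSeries.φ*Dβ≈α•β*Dφ α) n ⟩
    conv invφ (ι α • conv F (D φ)) n    ≈⟨ conv-•ʳ (ι α) invφ (conv F (D φ)) n ⟩
    ι α * conv invφ (conv F (D φ)) n    ≈⟨ *-cong refl (trans (conv-comm invφ _ n) (conv-assoc F (D φ) invφ n)) ⟩
    ι α * conv F Dlogφ n                ∎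
    where
    F : Series
    F = β α

  β-0 : ∀ α → β α 0 ≈ 1#
  β-0 α = trans (+-identityˡ _) (trans (*-cong 1#-homo refl) (*-identityˡ _))

  ψ≈r-Dlogφ : ψ ≈ₛ ιℕ r • one +ₛ -ₛ Dlogφ
  ψ≈r-Dlogφ zero    = +-cong (sym (*-identityʳ _)) refl
  ψ≈r-Dlogφ (suc n) = +-cong (sym (zeroʳ _)) refl

  module BinomialProduct (α γ : ℚ) where
    F G FG X : Series
    F  = β α
    G  = β γ
    FG = conv F G
    X  = conv FG Dlogφ

    FG-0 : FG 0 ≈ 1#
    FG-0 = trans (conv-0 F G) (trans (*-cong (β-0 α) (β-0 γ)) (*-identityˡ _))

    X-0 : X 0 ≈ 0#
    X-0 = trans (conv-0 FG Dlogφ) (trans (*-cong refl Dlogφ-0) (zeroʳ _))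

    F*[G*Dlogφ] : conv F (conv G Dlogφ) ≈ₛ X
    F*[G*Dlogφ] n = sym (conv-assoc F G Dlogφ n)

    [F*Dlogφ]*G : conv (conv F Dlogφ) G ≈ₛ X
    [F*Dlogφ]*G n = trans (conv-assoc F Dlogφ G n) (trans (conv-congˡ (conv-comm Dlogφ G) n) (F*[G*Dlogφ] n))

    D-FG : D FG ≈ₛ (ι α + ι γ) • X
    D-FG n = begin
        D FG n
      ≈⟨ D-conv F G n ⟩
        conv (D F) G n + conv F (D G) n
      ≈⟨ +-cong (conv-congʳ {g = G} (D-β α) n) (conv-congˡ (D-β γ) n) ⟩
        conv (ι α • conv F Dlogφ) G n + conv F (ι γ • conv G Dlogφ) n
      ≈⟨ +-cong (conv-•ˡ (ι α) (conv F Dlogφ) G n) (conv-•ʳ (ι γ) F (conv G Dlogφ) n) ⟩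
        ι α * conv (conv F Dlogφ) G n + ι γ * conv F (conv G Dlogφ) n
      ≈⟨ +-cong (*-cong refl ([F*Dlogφ]*G n)) (*-cong refl (F*[G*Dlogφ] n)) ⟩
        ι α * X n + ι γ * X n
      ≈⟨ distribʳ _ _ _ ⟨
        (ι α + ι γ) * X n
      ∎

    X-suc : ∀ {ρ} n → ρ * (ι α + ι γ) ≈ ιℕ (suc n) → X (suc n) ≈ ρ * FG (suc n)
    X-suc {ρ} n ρ[α+γ]≈1+n = ιℕ-suc-cancelˡ n (begin
      ιℕ (suc n) * X (suc n)            ≈⟨ *-cong (sym ρ[α+γ]≈1+n) refl ⟩
      (ρ * (ι α + ι γ)) * X (suc n)     ≈⟨ *-assoc _ _ _ ⟩
      ρ * ((ι α + ι γ) * X (suc n))     ≈⟨ *-cong refl (D-FG (suc n)) ⟨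
      ρ * (ιℕ (suc n) * FG (suc n))     ≈⟨ x∙yz≈y∙xz _ _ _ ⟩
      ιℕ (suc n) * (ρ * FG (suc n))     ∎)

    F*ψ*G : conv (conv F ψ) G ≈ₛ ιℕ r • FG +ₛ -ₛ X
    F*ψ*G n = begin
        conv (conv F ψ) G n
      ≈⟨ trans (conv-assoc F ψ G n) (conv-congˡ (conv-comm ψ G) n) ⟩
        conv F (conv G ψ) n
      ≈⟨ trans (sym (conv-assoc F G ψ n)) (conv-congˡ ψ≈r-Dlogφ n) ⟩
        conv FG (ιℕ r • one +ₛ -ₛ Dlogφ) n
      ≈⟨ conv-distribˡ FG (ιℕ r • one) (-ₛ Dlogφ) n ⟩
        conv FG (ιℕ r • one) n + conv FG (-ₛ Dlogφ) n
      ≈⟨ +-cong (trans (conv-•ʳ (ιℕ r) FG one n) (*-cong refl (conv-identityʳ FG n))) (conv-negʳ FG Dlogφ n) ⟩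
        ιℕ r * FG n + - X n
      ∎

    F*ψ*G-0 : conv (conv F ψ) G 0 ≈ ιℕ r
    F*ψ*G-0 = trans (F*ψ*G 0)
      (trans (+-cong (trans (*-cong refl FG-0) (*-identityʳ _)) (trans (-‿cong X-0) -0#≈0#)) (+-identityʳ _))

    F*ψ*G-suc : ∀ n → ιℕ r * (ι α + ι γ) ≈ ιℕ (suc n) → conv (conv F ψ) G (suc n) ≈ 0#
    F*ψ*G-suc n r[α+γ]≈1+n =
      trans (F*ψ*G (suc n)) (trans (+-cong refl (-‿cong (X-suc n r[α+γ]≈1+n))) (-‿inverseʳ _))

    F*[e•G-DG] : ∀ e → conv F (e • G +ₛ -ₛ D G) ≈ₛ e • FG +ₛ -ₛ (ι γ • X)
    F*[e•G-DG] e n = begin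
        conv F (e • G +ₛ -ₛ D G) n
      ≈⟨ conv-distribˡ F (e • G) (-ₛ D G) n ⟩
        conv F (e • G) n + conv F (-ₛ D G) n
      ≈⟨ +-cong (conv-•ʳ e F G n) (conv-negʳ F (D G) n) ⟩
        e * FG n + - conv F (D G) n
      ≈⟨ +-cong refl (-‿cong (trans (conv-congˡ (D-β γ) n) (conv-•ʳ (ι γ) F (conv G Dlogφ) n))) ⟩
        e * FG n + - (ι γ * conv F (conv G Dlogφ) n)
      ≈⟨ +-cong refl (-‿cong (*-cong refl (F*[G*Dlogφ] n))) ⟩
        e * FG n + - (ι γ * X n)
      ∎

    F*[e•G-DG]-0 : ∀ e → conv F (e • G +ₛ -ₛ D G) 0 ≈ e
    F*[e•G-DG]-0 e = trans (F*[e•G-DG] e 0)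
      (trans (+-cong (trans (*-cong refl FG-0) (*-identityʳ _)) (trans (-‿cong (trans (*-cong refl X-0) (zeroʳ _))) -0#≈0#))
             (+-identityʳ _))

    F*[e•G-DG]-suc : ∀ {ρ} e n → e ≈ ρ * ι γ → ρ * (ι α + ι γ) ≈ ιℕ (suc n) →
                     conv F (e • G +ₛ -ₛ D G) (suc n) ≈ 0#
    F*[e•G-DG]-suc {ρ} e n e≈ργ ρ[α+γ]≈1+n =
      trans (F*[e•G-DG] e (suc n)) (trans (+-cong refl (-‿cong γX≈eFG)) (-‿inverseʳ _))
      where
      γX≈eFG : ι γ * X (suc n) ≈ e * FG (suc n)
      γX≈eFG = trans (*-cong refl (X-suc n ρ[α+γ]≈1+n))
                     (trans (sym (*-assoc _ _ _)) (*-cong (trans (*-comm _ _) (sym e≈ργ)) refl))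

module LowerTriangular (R : CommutativeRing 0ℓ 0ℓ) (ι : ℚ → CommutativeRing.Carrier R)
                       (r : ℕ) (s : Fin r → CommutativeRing.Carrier R) where
  open CommutativeRing R renaming (Carrier to A)
  open Setup R ι r s
  open PowerSeries R ι r s

  diag-≡ : ∀ {m} (d : Fin m → A) {i j} → i ≡ j → diag d i j ≈ d i
  diag-≡ d {i} {j} i≡j with i FinP.≟ j
  ... | yes _   = refl
  ... | no  i≢j = contradiction i≡j i≢j

  diag-≢ : ∀ {m} (d : Fin m → A) {i j} → i ≢ j → diag d i j ≈ 0#
  diag-≢ d {i} {j} i≢j with i FinP.≟ j
  ... | yes i≡j = contradiction i≡j i≢j
  ... | no  _   = refl

  sumFin-cong : ∀ m {f g : Fin m → A} → (∀ k → f k ≈ g k) → sumFin m f ≈ sumFin m g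
  sumFin-cong zero    f≈g = refl
  sumFin-cong (suc m) f≈g = +-cong (f≈g Fin.zero) (sumFin-cong m (λ k → f≈g (Fin.suc k)))

  sumFin-zero : ∀ m → sumFin m (λ _ → 0#) ≈ 0#
  sumFin-zero zero    = refl
  sumFin-zero (suc m) = trans (+-identityˡ _) (sumFin-zero m)

  sumFin-toℕ : ∀ m (h : ℕ → A) → sumFin m (λ k → h (toℕ k)) ≈ sumTo m h
  sumFin-toℕ zero    h = refl
  sumFin-toℕ (suc m) h = trans (+-cong refl (sumFin-toℕ m (λ k → h (suc k)))) (sym (sumTo-uncons m h))

  sumFin-δ : ∀ m (f : Fin m → A) k → (∀ l → l ≢ k → f l ≈ 0#) → sumFin m f ≈ f k
  sumFin-δ (suc m) f Fin.zero    vanish =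
    trans (+-cong refl (trans (sumFin-cong m (λ l → vanish (Fin.suc l) (λ ()))) (sumFin-zero m))) (+-identityʳ _)
  sumFin-δ (suc m) f (Fin.suc k) vanish =
    trans (+-cong (vanish Fin.zero (λ ())) (sumFin-δ m (λ l → f (Fin.suc l)) k vanish-suc)) (+-identityˡ _)
    where
    vanish-suc : ∀ l → l ≢ k → f (Fin.suc l) ≈ 0#
    vanish-suc l l≢k = vanish (Fin.suc l) (λ 1+l≡1+k → l≢k (FinP.suc-injective 1+l≡1+k))

  sumFin-*-diag : ∀ m (Y d : Fin m → A) k → sumFin m (λ l → Y l * diag d l k) ≈ Y k * d k
  sumFin-*-diag m Y d k =
    trans (sumFin-δ m _ k (λ l l≢k → trans (*-cong refl (diag-≢ d l≢k)) (zeroʳ _))) (*-cong refl (diag-≡ d ≡.refl))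

  sumFin-lowerAt-conv : ∀ m F H (i : Fin m) k →
    sumFin m (λ l → lowerAt F (toℕ i) (toℕ l) * lowerAt H (toℕ l) k) ≈ lowerAt (conv F H) (toℕ i) k
  sumFin-lowerAt-conv m F H i k = trans (sumFin-toℕ m _) (sumTo-lowerAt-conv m F H k (FinP.toℕ<n i))

  lowerAt≈diag : ∀ {m} (H : Series) (d : Fin m → A) (i j : Fin m) →
                 (i ≡ j → H 0 ≈ d i) → (toℕ j < toℕ i → H (toℕ i ∸ toℕ j) ≈ 0#) →
                 lowerAt H (toℕ i) (toℕ j) ≈ diag d i j
  lowerAt≈diag H d i j on-diagonal below-diagonal with ℕP.<-cmp (toℕ i) (toℕ j)
  ... | tri< i<j _ _ =
    trans (lowerAt-> H i<j) (sym (diag-≢ d (λ i≡j → ℕP.<⇒≢ i<j (≡.cong toℕ i≡j))))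
  ... | tri> _ _ j<i =
    trans (lowerAt-≤ H (ℕP.<⇒≤ j<i))
          (trans (below-diagonal j<i) (sym (diag-≢ d (λ i≡j → ℕP.<⇒≢ j<i (≡.cong toℕ (≡.sym i≡j))))))
  ... | tri≈ _ i≡j _ with FinP.toℕ-injective i≡j
  ...   | ≡.refl =
    trans (lowerAt-≤ H {toℕ i} ℕP.≤-refl)
          (trans (reflexive (≡.cong H (ℕP.n∸n≡0 (toℕ i)))) (trans (on-diagonal ≡.refl) (sym (diag-≡ d ≡.refl))))

module Identities (R : CommutativeRing 0ℓ 0ℓ) (ι : ℚ → CommutativeRing.Carrier R)
                  (hom : IsRingHomomorphism ℚ.+-*-rawRing (CommutativeRing.rawRing R) ι)
                  (r′ : ℕ) (s : Fin (suc r′) → CommutativeRing.Carrier R) where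
  open CommutativeRing R renaming (Carrier to A)
  open Setup R ι (suc r′) s
  open PowerSeries R ι (suc r′) s
  open EulerOperator R ι hom (suc r′) s
  open LowerTriangular R ι (suc r′) s
  open IsRingHomomorphism hom using (*-homo; -‿homo)
  open import Algebra.Properties.Ring ring using (-‿distribʳ-*; ⁻¹-anti-homo‿-; [y-z]x≈yx-zx)
  open import Relation.Binary.Reasoning.Setoid setoid

  r : ℕ
  r = suc r′

  -- lamQ r _ i unfolds to λ̂ i.
  λ̂ : ℕ → ℚ
  λ̂ i = (+ r ℤ.- + suc i) ℚ./ r

  d : ℕ → A
  d i = ιℤ (+ r ℤ.- + suc i)

  r*λ̂≈d : ∀ i → ιℕ r * ι (λ̂ i) ≈ d i
  r*λ̂≈d i = trans (sym (*-homo _ _)) (reflexive (≡.cong ι (/1-*-/-cancel (+ r ℤ.- + suc i) r′)))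

  d-≤ : ∀ {j k} → j ≤ k → d k ≈ d j - ιℕ (k ∸ j)
  d-≤ {j} {k} j≤k = trans (reflexive (≡.cong ιℤ split)) (ιℤ-‿ (+ r ℤ.- + suc j) (+ (k ∸ j)))
    where
    sub-+ : ∀ a b c → a ℤ.- (b ℤ.+ c) ≡ (a ℤ.- b) ℤ.- c
    sub-+ = solve-∀
    split : + r ℤ.- + suc k ≡ (+ r ℤ.- + suc j) ℤ.- + (k ∸ j)
    split = ≡.trans (≡.cong (λ n → + r ℤ.- + suc n) (≡.sym (ℕP.m+[n∸m]≡n j≤k)))
                    (sub-+ (+ r) (+ suc j) (+ (k ∸ j)))

  r*[λ̂j-λ̂k] : ∀ {j k} → j ≤ k → ιℕ r * (ι (ℚ.- λ̂ k) + ι (λ̂ j)) ≈ ιℕ (k ∸ j)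
  r*[λ̂j-λ̂k] {j} {k} j≤k = begin
    ιℕ r * (ι (ℚ.- λ̂ k) + ι (λ̂ j))        ≈⟨ *-cong refl (+-cong (-‿homo _) refl) ⟩
    ιℕ r * (- ι (λ̂ k) + ι (λ̂ j))          ≈⟨ distribˡ _ _ _ ⟩
    ιℕ r * - ι (λ̂ k) + ιℕ r * ι (λ̂ j)      ≈⟨ +-cong (sym (-‿distribʳ-* _ _)) refl ⟩
    - (ιℕ r * ι (λ̂ k)) + ιℕ r * ι (λ̂ j)    ≈⟨ +-cong (-‿cong (trans (r*λ̂≈d k) (d-≤ j≤k))) (r*λ̂≈d j) ⟩
    - (d j - ιℕ (k ∸ j)) + d j             ≈⟨ +-cong (⁻¹-anti-homo‿- _ _) refl ⟩
    (ιℕ (k ∸ j) - d j) + d j               ≈⟨ +-assoc _ _ _ ⟩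
    ιℕ (k ∸ j) + (- d j + d j)             ≈⟨ +-cong refl (-‿inverseˡ _) ⟩
    ιℕ (k ∸ j) + 0#                        ≈⟨ +-identityʳ _ ⟩
    ιℕ (k ∸ j)                             ∎

  below-diagonal : ∀ (H : Series) {i j} → j < i →
                   (∀ n → ιℕ r * (ι (ℚ.- λ̂ i) + ι (λ̂ j)) ≈ ιℕ (suc n) → H (suc n) ≈ 0#) → H (i ∸ j) ≈ 0#
  below-diagonal H {suc i} {j} (s≤s j≤i) vanish =
    trans (reflexive (≡.cong H 1+i∸j≡1+[i∸j]))
          (vanish (i ∸ j) (trans (r*[λ̂j-λ̂k] (ℕP.m≤n⇒m≤1+n j≤i)) (reflexive (≡.cong ιℕ 1+i∸j≡1+[i∸j]))))
    where
    1+i∸j≡1+[i∸j] : suc i ∸ j ≡ suc (i ∸ j)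
    1+i∸j≡1+[i∸j] = ℕP.+-∸-assoc 1 j≤i

  d-*-lowerAt : ∀ Y G k j → (Y * d k) * lowerAt G k j ≈ Y * lowerAt (d j • G +ₛ -ₛ D G) k j
  d-*-lowerAt Y G k j with k ℕ.<? j
  ... | yes k<j =
    trans (*-cong refl (lowerAt-> G k<j)) (trans (zeroʳ _) (sym (trans (*-cong refl (lowerAt-> _ k<j)) (zeroʳ _))))
  ... | no  k≮j = begin
      (Y * d k) * lowerAt G k j
    ≈⟨ trans (*-assoc _ _ _) (*-cong refl (*-cong (d-≤ j≤k) (lowerAt-≤ G j≤k))) ⟩
      Y * ((d j - ιℕ (k ∸ j)) * G (k ∸ j))
    ≈⟨ *-cong refl ([y-z]x≈yx-zx _ _ _) ⟩
      Y * (d j * G (k ∸ j) - ιℕ (k ∸ j) * G (k ∸ j))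
    ≈⟨ *-cong refl (lowerAt-≤ _ j≤k) ⟨
      Y * lowerAt (d j • G +ₛ -ₛ D G) k j
    ∎
    where
    j≤k : j ≤ k
    j≤k = ℕP.≮⇒≥ k≮j

  identity-i : ∀ m → ((P m (λ i → ℚ.- λ̂ (toℕ i)) ⊗ S m ψ) ⊗ Q m (λ j → λ̂ (toℕ j))) ≋ scal m (ιℕ r)
  identity-i m i j = begin
      sumFin m (λ k → sumFin m (λ l → lowerAt F (toℕ i) (toℕ l) * lowerAt ψ (toℕ l) (toℕ k))
                      * lowerAt G (toℕ k) (toℕ j))
    ≈⟨ sumFin-cong m (λ k → *-cong (sumFin-lowerAt-conv m F ψ i (toℕ k)) refl) ⟩
      sumFin m (λ k → lowerAt (conv F ψ) (toℕ i) (toℕ k) * lowerAt G (toℕ k) (toℕ j))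
    ≈⟨ sumFin-lowerAt-conv m (conv F ψ) G i (toℕ j) ⟩
      lowerAt H (toℕ i) (toℕ j)
    ≈⟨ lowerAt≈diag H _ i j (λ _ → F*ψ*G-0) (λ j<i → below-diagonal H j<i F*ψ*G-suc) ⟩
      scal m (ιℕ r) i j
    ∎
    where
    open BinomialProduct (ℚ.- λ̂ (toℕ i)) (λ̂ (toℕ j))
    H : Series
    H = conv (conv F ψ) G

  identity-ii : ∀ m → ((P m (λ i → ℚ.- λ̂ (toℕ i)) ⊗ diag (λ i → d (toℕ i))) ⊗ Q m (λ j → λ̂ (toℕ j)))
                      ≋ diag (λ i → d (toℕ i))
  identity-ii m i j = begin
      sumFin m (λ k → sumFin m (λ l → lowerAt F (toℕ i) (toℕ l) * diag dₘ l k) * lowerAt G (toℕ k) (toℕ j))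
    ≈⟨ sumFin-cong m (λ k → *-cong (sumFin-*-diag m (λ l → lowerAt F (toℕ i) (toℕ l)) dₘ k) refl) ⟩
      sumFin m (λ k → (lowerAt F (toℕ i) (toℕ k) * d (toℕ k)) * lowerAt G (toℕ k) (toℕ j))
    ≈⟨ sumFin-cong m (λ k → d-*-lowerAt _ G (toℕ k) (toℕ j)) ⟩
      sumFin m (λ k → lowerAt F (toℕ i) (toℕ k) * lowerAt (d (toℕ j) • G +ₛ -ₛ D G) (toℕ k) (toℕ j))
    ≈⟨ sumFin-lowerAt-conv m F _ i (toℕ j) ⟩
      lowerAt H (toℕ i) (toℕ j)
    ≈⟨ lowerAt≈diag H dₘ i j (λ i≡j → trans (F*[e•G-DG]-0 _) (reflexive (≡.cong dₘ (≡.sym i≡j))))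
                             (λ j<i → below-diagonal H j<i (λ n → F*[e•G-DG]-suc _ n (sym (r*λ̂≈d (toℕ j))))) ⟩
      diag dₘ i j
    ∎
    where
    open BinomialProduct (ℚ.- λ̂ (toℕ i)) (λ̂ (toℕ j))
    dₘ : Fin m → A
    dₘ k = d (toℕ k)
    H : Series
    H = conv F (d (toℕ j) • G +ₛ -ₛ D G)

lemma12 : (R : CommutativeRing 0ℓ 0ℓ) (ι : ℚ → CommutativeRing.Carrier R)
    → IsRingHomomorphism ℚ.+-*-rawRing (CommutativeRing.rawRing R) ι
    → (r : ℕ) (2≤r : 2 ≤ r) (m : ℕ) → 1 ≤ m
    → (s : Fin r → CommutativeRing.Carrier R)
    → let open Setup R ι r s in
    (((P m (λ i → ℚ.- lamQ r 2≤r (toℕ i)) ⊗ S m ψ) ⊗ Q m (λ j → lamQ r 2≤r (toℕ j)))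
    ≋ scal m (ι (+ r ℚ./ 1)))
    × (((P m (λ i → ℚ.- lamQ r 2≤r (toℕ i)) ⊗ diag (λ i → ι ((+ r ℤ.- + suc (toℕ i)) ℚ./ 1)))
    ⊗ Q m (λ j → lamQ r 2≤r (toℕ j)))
    ≋ diag (λ i → ι ((+ r ℤ.- + suc (toℕ i)) ℚ./ 1)))
lemma12 R ι hom (suc r′) _ m _ s = identity-i m , identity-ii m
  where open Identities R ι hom r′ s
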